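{- Let $\sigma,\sigma'$ be configurations of a threshold automaton and suppose $\phi_{\mathit{steady}}(\sigma,\sigma')$ holds with assignment $Y=(y_r)_{r\in\mathcal R}$. Suppose $t$ is a rule with $y_t>0$ and $\sigma.\kappa(t.\mathit{from})>0$. If there is no fireable cycle at $t.\mathit{from}$ with respect to $Y$, then $\phi_{\mathit{steady}}(t(\sigma),\sigma')$ holds with some assignment $Z$ such that $Z<Y$.
   Context: A threshold automaton $\mathsf{TA}=(\mathcal L,\mathcal I,\Gamma,\mathcal R)$ over environment $(\Pi,RC,N)$ ($\Pi$ parameters over $\mathbb N_0$, $RC\subseteq\mathbb N_0^\Pi$ integer-linear-definable, $N$ linear) has locations $\mathcal L$, shared variables $\Gamma$ over $\mathbb N_0$, and rules $r=(r.\mathit{from},r.\mathit{to},r.\varphi,r.\vec u)$ with $r.\varphi$ a conjunction of threshold guards (rise: $x\ge a_0+\sum_ia_ip_i$; fall: $x<a_0+\sum_ia_ip_i$; $x\in\Gamma,p_i\in\Pi,a_i\in\mathbb Q$) and $r.\vec u\in\{0,1\}^\Gamma$. A configuration $\sigma=(\sigma.\kappa,\sigma.\vec g,\sigma.\vec p)$ has $\sigma.\kappa\colon\mathcal L\to\mathbb N_0$, $\sigma.\vec g\in\mathbb N_0^\Gamma$, $\sigma.\vec p\in RC$, $\sum_\ell\sigma.\kappa(\ell)=N(\sigma.\vec p)$. $\sigma\models r.\varphi$ means $(\sigma.\vec g,\sigma.\vec p)$ satisfies $r.\varphi$. If $\sigma.\kappa(r.\mathit{from})>0$ and $\sigma\models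 r.\varphi$, then $r(\sigma)$ keeps parameters, has shared values $\sigma.\vec g+r.\vec u$ and moves one process from $r.\mathit{from}$ to $r.\mathit{to}$. The context $\omega(\sigma)$ is the set of rise guards of $\mathsf{TA}$ true in $\sigma$ plus fall guards false in $\sigma$. For configurations $\sigma,\sigma'$ and $X=(x_r)_{r\in\mathcal R}\in\mathbb N_0^{\mathcal R}$ consider: (base) $\sigma.\vec p=\sigma'.\vec p$, $\sigma.\vec p\in RC$, $N(\sigma.\vec p)=N(\sigma'.\vec p)$, $\omega(\sigma)=\omega(\sigma')$; (L) for all $\ell$: $\sum_{r.\mathit{to}=\ell}x_r-\sum_{r.\mathit{from}=\ell}x_r=\sigma'.\kappa(\ell)-\sigma.\kappa(\ell)$; ($\Gamma$) for all $z\in\Gamma$: $\sum_rx_r\,r.\vec u[z]=\sigma'.\vec g[z]-\sigma.\vec g[z]$; (R) $x_r>0\Rightarrow\sigma\models r.\varphi$ for all $r$; (appl) for every $r$ with $x_r>0$ there are rules $r_1,\dots,r_s$ with all $x_{r_i}>0$, $\sigma.\kappa(r_1.\mathit{from})>0$, $r_{i-1}.\mathit{to}=r_i.\mathit{from}$ for $1<i\le s$, $r_s=r$. $\phi_{\mathit{steady}}(\sigma,\sigma')\equiv(\text{base})\wedge\exists X\ge0[(\text{L})\wedge(\Gamma)\wedge(\text{R})\wedge(\text{appl})]$. "$\phi_{\mathit{steady}}(\sigma,\sigma')$ holds with assignment $Y=(y_r)$" means (base) holds and (L),($\Gamma$),(R),(appl) hold for $x_r=y_r$. For assignments $Y,Z$,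 $Z<Y$ means $\sum_rz_r<\sum_ry_r$. There is a fireable cycle at location $\ell$ with respect to $Y$ if there are rules $t_1,\dots,t_m$ with $y_{t_1},\dots,y_{t_m}>0$, $t_i.\mathit{to}=t_{i+1}.\mathit{from}$ for $i<m$, and $t_m.\mathit{to}=t_1.\mathit{from}=\ell$. -}

module Defs where

open import Data.Nat as ℕ using (ℕ; zero; suc)
open import Data.Integer as ℤ using (ℤ; +_)
open import Data.Rational as ℚ using (ℚ)
open import Data.Fin using (Fin; zero; suc; inject₁; fromℕ; _≟_)
open import Data.Bool using (Bool; true; false)
open import Data.List using (List)
open import Data.List.Membership.Propositional using (_∈_)
open import Data.Product using (Σ; ∃; ∃-syntax; _×_; _,_)
open import Data.Sum using (_⊎_)
open import Relation.Nullary using (¬_; yes; no)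
open import Relation.Binary.PropositionalEquality using (_≡_)

∑ : (n : ℕ) → (Fin n → ℕ) → ℕ
∑ zero    f = 0
∑ (suc n) f = f zero ℕ.+ ∑ n (λ i → f (suc i))

∑ℚ : (n : ℕ) → (Fin n → ℚ) → ℚ
∑ℚ zero    f = ℚ.0ℚ
∑ℚ (suc n) f = f zero ℚ.+ ∑ℚ n (λ i → f (suc i))

∑ℤ : (n : ℕ) → (Fin n → ℤ) → ℤ
∑ℤ zero    f = + 0
∑ℤ (suc n) f = f zero ℤ.+ ∑ℤ n (λ i → f (suc i))

ℕ→ℚ : ℕ → ℚ
ℕ→ℚ n = (+ n) ℚ./ 1

B→ℕ : Bool → ℕ
B→ℕ true  = 1
B→ℕ false = 0

data GuardKind : Set where
  rise fall : GuardKind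

record Guard (nΓ nΠ : ℕ) : Set where
  constructor guard
  field
    kind  : GuardKind
    var   : Fin nΓ
    a₀    : ℚ
    coeff : Fin nΠ → ℚ
open Guard public

threshold : ∀ {nΓ nΠ} → Guard nΓ nΠ → (Fin nΠ → ℕ) → ℚ
threshold {nΠ = nΠ} g p = a₀ g ℚ.+ ∑ℚ nΠ (λ i → coeff g i ℚ.* ℕ→ℚ (p i))

GuardHolds : ∀ {nΓ nΠ} → Guard nΓ nΠ → (Fin nΓ → ℕ) → (Fin nΠ → ℕ) → Set
GuardHolds g x p with kind g
... | rise = threshold g p ℚ.≤ ℕ→ℚ (x (var g))
... | fall = ℕ→ℚ (x (var g)) ℚ.< threshold g p

record Rule (nL nΓ nΠ : ℕ) : Set where
  field
    from : Fin nL
    to   : Fin nL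
    φ    : List (Guard nΓ nΠ)      -- conjunction of guards
    u    : Fin nΓ → Bool
open Rule public

record TA : Set₁ where
  field
    nL nΓ nΠ nR : ℕ
    rules : Fin nR → Rule nL nΓ nΠ
    RC : (Fin nΠ → ℕ) → Set
    N₀ : ℤ
    Nc : Fin nΠ → ℤ
open TA public

module _ (A : TA) where

  Loc = Fin (nL A)
  Var = Fin (nΓ A)
  Par = Fin (nΠ A)
  RuleIx = Fin (nR A)

  rule : RuleIx → Rule (nL A) (nΓ A) (nΠ A)
  rule r = rules A r

  Nval : (Par → ℕ) → ℤ
  Nval p = N₀ A ℤ.+ ∑ℤ (nΠ A) (λ i → Nc A i ℤ.* (+ p i))

  record Config : Set where
    constructor cfg
    field
      κ : Loc → ℕ
      g : Var → ℕ
      p : Par → ℕ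
  open Config public

  IsConfig : Config → Set
  IsConfig σ = RC A (p σ) × (+ ∑ (nL A) (κ σ) ≡ Nval (p σ))

  Sat : Config → List (Guard (nΓ A) (nΠ A)) → Set
  Sat σ gs = ∀ {gd} → gd ∈ gs → GuardHolds gd (g σ) (p σ)

  GuardOfTA : Guard (nΓ A) (nΠ A) → Set
  GuardOfTA gd = ∃[ r ] gd ∈ φ (rule r)

  ω : Config → Guard (nΓ A) (nΠ A) → Set
  ω σ gd = GuardOfTA gd ×
           ((kind gd ≡ rise × GuardHolds gd (g σ) (p σ)) ⊎
            (kind gd ≡ fall × ¬ GuardHolds gd (g σ) (p σ)))

  SameContext : Config → Config → Set
  SameContext σ σ' = ∀ gd → (ω σ gd → ω σ' gd) × (ω σ' gd → ω σ gd)

  ind : Loc → Loc → ℕ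
  ind i j with i ≟ j
  ... | yes _ = 1
  ... | no  _ = 0

  -- r(σ): move one process from r.from to r.to, add r.u to shared vars
  -- (used only when σ.κ(r.from) > 0 and σ ⊨ r.φ)
  apply : RuleIx → Config → Config
  apply r σ = cfg (λ ℓ → (κ σ ℓ ℕ.∸ ind ℓ (from (rule r))) ℕ.+ ind ℓ (to (rule r)))
                  (λ z → g σ z ℕ.+ B→ℕ (u (rule r) z))
                  (p σ)

  Assignment : Set
  Assignment = RuleIx → ℕ

  Base : Config → Config → Set
  Base σ σ' = (p σ ≡ p σ') × RC A (p σ) × (Nval (p σ) ≡ Nval (p σ')) × SameContext σ σ'

  CondL : Config → Config → Assignment → Set
  CondL σ σ' X = ∀ (ℓ : Loc) →
    (+ ∑ (nR A) (λ r → ind (to (rule r)) ℓ ℕ.* X r)) ℤ.- (+ ∑ (nR A) (λ r → ind (from (rule r)) ℓ ℕ.* X r))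
      ≡ (+ κ σ' ℓ) ℤ.- (+ κ σ ℓ)

  CondΓ : Config → Config → Assignment → Set
  CondΓ σ σ' X = ∀ (z : Var) →
    + ∑ (nR A) (λ r → X r ℕ.* B→ℕ (u (rule r) z)) ≡ (+ g σ' z) ℤ.- (+ g σ z)

  CondR : Config → Assignment → Set
  CondR σ X = ∀ (r : RuleIx) → 0 ℕ.< X r → Sat σ (φ (rule r))

  CondAppl : Config → Assignment → Set
  CondAppl σ X = ∀ (r : RuleIx) → 0 ℕ.< X r →
    ∃[ s ] Σ (Fin (suc s) → RuleIx) λ rs →
        (∀ i → 0 ℕ.< X (rs i))
      × (0 ℕ.< κ σ (from (rule (rs zero))))
      × (∀ (i : Fin s) → to (rule (rs (inject₁ i))) ≡ from (rule (rs (suc i))))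
      × (rs (fromℕ s) ≡ r)

  SteadyWith : Config → Config → Assignment → Set
  SteadyWith σ σ' X = Base σ σ' × CondL σ σ' X × CondΓ σ σ' X × CondR σ X × CondAppl σ X

  _<A_ : Assignment → Assignment → Set
  Z <A Y = ∑ (nR A) Z ℕ.< ∑ (nR A) Y

  FireableCycle : Loc → Assignment → Set
  FireableCycle ℓ Y =
    ∃[ m ] Σ (Fin (suc m) → RuleIx) λ ts →
        (∀ i → 0 ℕ.< Y (ts i))
      × (∀ (i : Fin m) → to (rule (ts (inject₁ i))) ≡ from (rule (ts (suc i))))
      × (to (rule (ts (fromℕ m))) ≡ ℓ)
      × (from (rule (ts zero)) ≡ ℓ)

-- Fire t once and let Z be Y with the count of t decreased by one. The
-- counting conditions (L) and (Γ) survive because t(σ) already accounts for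
-- that firing. Shared variables only grow, σ.g ≤ t(σ).g ≤ σ'.g, and guards
-- are monotone in them, so the context of t(σ) is squeezed between the equal
-- contexts of σ and σ'; this gives (base) and (R). For (appl), look at the
-- Y-path to a rule r after its last visit of ℓ₀ = t.from: no later step
-- leaves ℓ₀, so none is t and each keeps a positive count in Z. If the path
-- never visits ℓ₀, its start is still occupied in t(σ); if it last leaves ℓ₀
-- by t, it continues from t.to, which t(σ) occupies. Otherwise it has to
-- reach ℓ₀ in t(σ): either ℓ₀ is still occupied, or it is empty while a
-- Z-rule leaves it, and then by (L) a Z-rule q enters it. The Y-path to q
-- cannot visit ℓ₀, as that would close a fireable cycle at ℓ₀, so it uses
-- only Z-rules.
module Submission where

open import Defs
open import Data.Nat as ℕ using (ℕ; zero; suc; pred; _+_; _*_; _∸_; _≤_; _<_; z≤n)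
import Data.Nat.Properties as ℕP
open import Algebra.Properties.CommutativeSemigroup ℕP.+-commutativeSemigroup
  using () renaming (xy∙z≈xz∙y to +-right-comm)
open import Data.Integer as ℤ using (+_)
import Data.Integer.Properties as ℤP
open import Data.Integer.Tactic.RingSolver using (solve-∀)
open import Data.Rational as ℚ using (mkℚ)
import Data.Rational.Properties as ℚP
open import Data.Nat.Coprimality as Coprime using (1-coprimeTo)
open import Data.Fin using (Fin; zero; suc; inject₁; fromℕ; _≟_)
import Data.Fin.Properties as FinP
open import Function using (_∘_)
open import Data.Vec.Functional using (_∷_; updateAt)
open import Data.Vec.Functional.Properties using (updateAt-updates; updateAt-minimal)
open import Data.Product using (Σ; ∃-syntax; _×_; _,_; proj₁; proj₂)
open import Data.Sum using (inj₁; inj₂)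
open import Data.Empty using (⊥-elim)
open import Relation.Nullary using (¬_; yes; no)
open import Relation.Binary.PropositionalEquality
open import Relation.Binary.Construct.Closure.ReflexiveTransitive as Star
  using (Star; ε; _◅_; _◅◅_)

∑-cong : ∀ n {f g : Fin n → ℕ} → (∀ i → f i ≡ g i) → ∑ n f ≡ ∑ n g
∑-cong zero    f≗g = refl
∑-cong (suc n) f≗g = cong₂ _+_ (f≗g zero) (∑-cong n (λ i → f≗g (suc i)))

∑-perturb : ∀ n (f g : Fin n → ℕ) (i : Fin n) c →
  f i ≡ g i + c → (∀ j → j ≢ i → f j ≡ g j) → ∑ n f ≡ ∑ n g + c
∑-perturb (suc n) f g zero c fi≡gi+c f≗g = begin
  f zero + ∑ n (f ∘ suc)       ≡⟨ cong₂ _+_ fi≡gi+c (∑-cong n (λ j → f≗g (suc j) (λ ()))) ⟩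
  g zero + c + ∑ n (g ∘ suc)   ≡⟨ +-right-comm (g zero) c _ ⟩
  g zero + ∑ n (g ∘ suc) + c   ∎
  where open ≡-Reasoning
∑-perturb (suc n) f g (suc i) c fi≡gi+c f≗g = begin
  f zero + ∑ n (f ∘ suc)       ≡⟨ cong₂ _+_ (f≗g zero (λ ()))
                                    (∑-perturb n _ _ i c fi≡gi+c (λ j j≢i → f≗g (suc j) (j≢i ∘ FinP.suc-injective))) ⟩
  g zero + (∑ n (g ∘ suc) + c) ≡⟨ ℕP.+-assoc (g zero) _ c ⟨
  g zero + ∑ n (g ∘ suc) + c   ∎
  where open ≡-Reasoning

term≤∑ : ∀ n (f : Fin n → ℕ) i → f i ≤ ∑ n f
term≤∑ (suc n) f zero    = ℕP.m≤m+n (f zero) _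
term≤∑ (suc n) f (suc i) = ℕP.≤-trans (term≤∑ n (f ∘ suc) i) (ℕP.m≤n+m _ (f zero))

∑-pos⇒term-pos : ∀ n (f : Fin n → ℕ) → 0 < ∑ n f → ∃[ i ] 0 < f i
∑-pos⇒term-pos (suc n) f ∑>0 with f zero in fz
... | suc _ = zero , subst (0 <_) (sym fz) (ℕ.s≤s z≤n)
... | zero with ∑-pos⇒term-pos n (f ∘ suc) ∑>0
...   | i , fi>0 = suc i , fi>0

+k≡+m-+n⇒n+k≡m : ∀ {k m n} → + k ≡ + m ℤ.- + n → n + k ≡ m
+k≡+m-+n⇒n+k≡m {k} {m} {n} k≡m-n = ℤP.+-injective (begin
  + n ℤ.+ + k             ≡⟨ cong (λ x → + n ℤ.+ x) k≡m-n ⟩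
  + n ℤ.+ (+ m ℤ.- + n)   ≡⟨ cancel (+ n) (+ m) ⟩
  + m                     ∎)
  where
  open ≡-Reasoning
  cancel : ∀ N M → N ℤ.+ (M ℤ.- N) ≡ M
  cancel = solve-∀

-- Moving c units into and d units out of a place changes its level from k to
-- k₁ (second hypothesis) and its net flow from (a + c) - (b + d) to a - b.
net-flow-shift : ∀ a b c d k k₁ k' → + (a + c) ℤ.- + (b + d) ≡ + k' ℤ.- + k →
  k₁ + d ≡ k + c → + a ℤ.- + b ≡ + k' ℤ.- + k₁
net-flow-shift a b c d k k₁ k' flow level = begin
  + a ℤ.- + b                                                    ≡⟨ regroup (+ a) (+ b) (+ c) (+ d) (+ k) (+ k₁) ⟩
  + (a + c) ℤ.- + (b + d) ℤ.- + (k + c) ℤ.+ + (k₁ + d) ℤ.+ + k ℤ.- + k₁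
    ≡⟨ cong₂ (λ x y → x ℤ.- + (k + c) ℤ.+ y ℤ.+ + k ℤ.- + k₁) flow (cong +_ level) ⟩
  + k' ℤ.- + k ℤ.- + (k + c) ℤ.+ + (k + c) ℤ.+ + k ℤ.- + k₁     ≡⟨ cancel (+ k') (+ k) (+ c) (+ k₁) ⟩
  + k' ℤ.- + k₁                                                  ∎
  where
  open ≡-Reasoning
  regroup : ∀ A B C D K K₁ →
    A ℤ.- B ≡ (A ℤ.+ C) ℤ.- (B ℤ.+ D) ℤ.- (K ℤ.+ C) ℤ.+ (K₁ ℤ.+ D) ℤ.+ K ℤ.- K₁
  regroup = solve-∀
  cancel : ∀ K' K C K₁ → K' ℤ.- K ℤ.- (K ℤ.+ C) ℤ.+ (K ℤ.+ C) ℤ.+ K ℤ.- K₁ ≡ K' ℤ.- K₁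
  cancel = solve-∀

+s+c≡+m-+n⇒+s≡+m-+[n+c] : ∀ s c m n → + (s + c) ≡ + m ℤ.- + n → + s ≡ + m ℤ.- + (n + c)
+s+c≡+m-+n⇒+s≡+m-+[n+c] s c m n eq = begin
  + s                  ≡⟨ add-sub (+ s) (+ c) ⟩
  + (s + c) ℤ.- + c    ≡⟨ cong (ℤ._- + c) eq ⟩
  + m ℤ.- + n ℤ.- + c  ≡⟨ sub-sub (+ m) (+ n) (+ c) ⟩
  + m ℤ.- + (n + c)    ∎
  where
  open ≡-Reasoning
  add-sub : ∀ S C → S ≡ S ℤ.+ C ℤ.- C
  add-sub = solve-∀
  sub-sub : ∀ M N C → M ℤ.- N ℤ.- C ≡ M ℤ.- (N ℤ.+ C)
  sub-sub = solve-∀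

ℕ→ℚ-mono-≤ : ∀ {m n} → m ≤ n → ℕ→ℚ m ℚ.≤ ℕ→ℚ n
ℕ→ℚ-mono-≤ {m} {n} m≤n = subst₂ ℚ._≤_ (sym (as-mkℚ m)) (sym (as-mkℚ n))
  (ℚ.*≤* (subst₂ ℤ._≤_ (sym (ℤP.*-identityʳ (+ m))) (sym (ℤP.*-identityʳ (+ n))) (ℤ.+≤+ m≤n)))
  where
  as-mkℚ : ∀ k → ℕ→ℚ k ≡ mkℚ (+ k) 0 (Coprime.sym (1-coprimeTo k))
  as-mkℚ k = ℚP.normalize-coprime (Coprime.sym (1-coprimeTo k))

rise-mono : ∀ {nΓ nΠ} (gd : Guard nΓ nΠ) {x y : Fin nΓ → ℕ} {p q : Fin nΠ → ℕ} → kind gd ≡ rise →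
  p ≡ q → (∀ z → x z ≤ y z) → GuardHolds gd x p → GuardHolds gd y q
rise-mono (guard rise x _ _) refl refl ≤ holds = ℚP.≤-trans holds (ℕ→ℚ-mono-≤ (≤ x))

fall-antitone : ∀ {nΓ nΠ} (gd : Guard nΓ nΠ) {x y : Fin nΓ → ℕ} {p q : Fin nΠ → ℕ} → kind gd ≡ fall →
  p ≡ q → (∀ z → x z ≤ y z) → GuardHolds gd y p → GuardHolds gd x q
fall-antitone (guard fall x _ _) refl refl ≤ holds = ℚP.≤-<-trans (ℕ→ℚ-mono-≤ (≤ x)) holds

module _ (A : TA) where

  private
    src tgt : RuleIx A → Loc A
    src r = from (rule A r)
    tgt r = to (rule A r)

  ind-refl : ∀ ℓ → ind A ℓ ℓ ≡ 1
  ind-refl ℓ with ℓ ≟ ℓ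
  ... | yes _  = refl
  ... | no ℓ≢ℓ = ⊥-elim (ℓ≢ℓ refl)

  ind-≢ : ∀ {ℓ ℓ'} → ℓ ≢ ℓ' → ind A ℓ ℓ' ≡ 0
  ind-≢ {ℓ} {ℓ'} ℓ≢ℓ' with ℓ ≟ ℓ'
  ... | yes ℓ≡ℓ' = ⊥-elim (ℓ≢ℓ' ℓ≡ℓ')
  ... | no _     = refl

  ind-sym : ∀ ℓ ℓ' → ind A ℓ ℓ' ≡ ind A ℓ' ℓ
  ind-sym ℓ ℓ' with ℓ ≟ ℓ'
  ... | yes refl  = sym (ind-refl ℓ)
  ... | no ℓ≢ℓ'   = sym (ind-≢ (ℓ≢ℓ' ∘ sym))

  ind-*-pos : ∀ ℓ ℓ' x → 0 < ind A ℓ ℓ' * x → ℓ ≡ ℓ' × 0 < x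
  ind-*-pos ℓ ℓ' x pos with ℓ ≟ ℓ'
  ... | yes ℓ≡ℓ' = ℓ≡ℓ' , subst (0 <_) (ℕP.+-identityʳ x) pos
  ... | no _     = ⊥-elim (ℕP.n≮0 pos)

  record _≼_ (σ τ : Config A) : Set where
    constructor _,_
    field
      same-params : p σ ≡ p τ
      shared-≤    : ∀ z → g σ z ≤ g τ z

  ω-mono : ∀ {σ τ} → σ ≼ τ → ∀ gd → ω A σ gd → ω A τ gd
  ω-mono (p≡ , g≤) gd (ofTA , inj₁ (isRise , holds)) =
    ofTA , inj₁ (isRise , rise-mono gd isRise p≡ g≤ holds)
  ω-mono (p≡ , g≤) gd (ofTA , inj₂ (isFall , fails)) =
    ofTA , inj₂ (isFall , λ holds → fails (fall-antitone gd isFall (sym p≡) g≤ holds))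

  context-between : ∀ {σ τ σ'} → σ ≼ τ → τ ≼ σ' → SameContext A σ σ' → SameContext A τ σ'
  context-between σ≼τ τ≼σ' same gd = ω-mono τ≼σ' gd , λ inσ' → ω-mono σ≼τ gd (proj₂ (same gd) inσ')

  -- A fall guard that fails in τ would be in ω(σ') = ω(σ), so it would fail in σ.
  guard-persists : ∀ {σ τ σ'} → σ ≼ τ → τ ≼ σ' → SameContext A σ σ' →
    ∀ gd → GuardOfTA A gd → GuardHolds gd (g σ) (p σ) → GuardHolds gd (g τ) (p τ)
  guard-persists (p≡ , g≤) τ≼σ' same gd@(guard rise _ _ _) ofTA holds =
    rise-mono gd refl p≡ g≤ holds
  guard-persists {σ} {τ} σ≼τ τ≼σ' same gd@(guard fall x _ _) ofTA holds
    with ℕ→ℚ (g τ x) ℚP.<? threshold gd (p τ)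
  ... | yes holdsτ = holdsτ
  ... | no failsτ with proj₂ (same gd) (ω-mono τ≼σ' gd (ofTA , inj₂ (refl , failsτ)))
  ...   | _ , inj₂ (_ , failsσ) = ⊥-elim (failsσ holds)

  CondΓ⇒shared-≤ : ∀ {σ σ' X} → CondΓ A σ σ' X → ∀ z → g σ z ≤ g σ' z
  CondΓ⇒shared-≤ {σ} condΓ z = subst (g σ z ≤_) (+k≡+m-+n⇒n+k≡m (condΓ z)) (ℕP.m≤m+n _ _)

  Active : Assignment A → RuleIx A → Set
  Active X r = 0 < X r

  data Step (P : RuleIx A → Set) : Loc A → Loc A → Set where
    fire : ∀ {r} → P r → Step P (src r) (tgt r)

  step-map : ∀ {P Q : RuleIx A → Set} → (∀ {r} → P r → Q r) → ∀ {ℓ ℓ'} → Step P ℓ ℓ' → Step Q ℓ ℓ'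
  step-map f (fire pr) = fire (f pr)

  Reachable : Config A → (RuleIx A → Set) → Loc A → Set
  Reachable σ P ℓ = ∃[ ℓ₀ ] 0 < κ σ ℓ₀ × Star (Step P) ℓ₀ ℓ

  Linked : ∀ {s} → (Fin (suc s) → RuleIx A) → Set
  Linked {s} rs = ∀ (i : Fin s) → tgt (rs (inject₁ i)) ≡ src (rs (suc i))

  path-from-rules : ∀ {P} s (rs : Fin (suc s) → RuleIx A) → (∀ i → P (rs i)) → Linked rs →
    Star (Step P) (src (rs zero)) (src (rs (fromℕ s)))
  path-from-rules zero    rs all-P linked = ε
  path-from-rules {P} (suc s) rs all-P linked = fire (all-P zero) ◅
    subst (λ ℓ → Star (Step P) ℓ (src (rs (fromℕ (suc s))))) (sym (linked zero))
      (path-from-rules s (rs ∘ suc) (all-P ∘ suc) (linked ∘ suc))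

  rules-from-path : ∀ {P ℓ r} → Star (Step P) ℓ (src r) → P r →
    ∃[ s ] Σ (Fin (suc s) → RuleIx A) λ rs →
      (∀ i → P (rs i)) × src (rs zero) ≡ ℓ × Linked rs × rs (fromℕ s) ≡ r
  rules-from-path {r = r} ε Pr = 0 , (λ _ → r) , (λ _ → Pr) , refl , (λ ()) , refl
  rules-from-path {P} (fire {r₀} Pr₀ ◅ path) Pr with rules-from-path path Pr
  ... | s , rs , all-P , starts , linked , ends = suc s , r₀ ∷ rs , all-P′ , refl , linked′ , ends
    where
    all-P′ : ∀ i → P ((r₀ ∷ rs) i)
    all-P′ zero    = Pr₀
    all-P′ (suc i) = all-P i
    linked′ : Linked (r₀ ∷ rs)
    linked′ zero    = sym starts
    linked′ (suc i) = linked i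

  appl⇒reachable : ∀ {σ X} → CondAppl A σ X → ∀ r → 0 < X r → Reachable σ (Active X) (src r)
  appl⇒reachable appl r Xr>0 with appl r Xr>0
  ... | s , rs , all-active , occupied , linked , ends =
    src (rs zero) , occupied , subst (λ q → Star _ _ (src q)) ends (path-from-rules s rs all-active linked)

  reachable⇒appl : ∀ {σ X} → (∀ r → 0 < X r → Reachable σ (Active X) (src r)) → CondAppl A σ X
  reachable⇒appl {σ} reach r Xr>0 with reach r Xr>0
  ... | ℓ , occupied , path with rules-from-path path Xr>0
  ...   | s , rs , all-active , starts , linked , ends =
    s , rs , all-active , subst (λ ℓ′ → 0 < κ σ ℓ′) (sym starts) occupied , linked , ends

  cycle : ∀ {Y ℓ q} → Star (Step (Active Y)) ℓ (src q) → 0 < Y q → tgt q ≡ ℓ → FireableCycle A ℓ Y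
  cycle path Yq>0 closes with rules-from-path path Yq>0
  ... | s , rs , all-active , starts , linked , ends =
    s , rs , all-active , linked , trans (cong tgt ends) closes , starts

  Avoiding : Loc A → (RuleIx A → Set) → RuleIx A → Set
  Avoiding a P r = P r × src r ≢ a

  data LastVisit (a : Loc A) (P : RuleIx A → Set) (ℓ m : Loc A) : Set where
    avoids  : ℓ ≢ a → Star (Step (Avoiding a P)) ℓ m → LastVisit a P ℓ m
    endsAt  : m ≡ a → LastVisit a P ℓ m
    exitsBy : ∀ {r} → P r → src r ≡ a → Star (Step (Avoiding a P)) (tgt r) m → LastVisit a P ℓ m

  lastVisit : ∀ a {P ℓ m} → Star (Step P) ℓ m → LastVisit a P ℓ m
  lastVisit a {ℓ = ℓ} ε with ℓ ≟ a
  ... | yes ℓ≡a = endsAt ℓ≡a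
  ... | no ℓ≢a  = avoids ℓ≢a ε
  lastVisit a (fire {r} Pr ◅ path) with lastVisit a path
  ... | endsAt m≡a          = endsAt m≡a
  ... | exitsBy Pq q≡a rest = exitsBy Pq q≡a rest
  ... | avoids _ rest with src r ≟ a
  ...   | yes r≡a = exitsBy Pr r≡a rest
  ...   | no r≢a  = avoids r≢a (fire (Pr , r≢a) ◅ rest)

  inflow : ∀ {τ τ' X ℓ r} → CondL A τ τ' X → κ τ ℓ ≡ 0 → 0 < X r → src r ≡ ℓ →
    ∃[ q ] 0 < X q × tgt q ≡ ℓ
  inflow {τ} {τ'} {X} {ℓ} {r} condL empty Xr>0 refl =
    entering (∑-pos⇒term-pos (nR A) In (ℕP.<-≤-trans out>0 out≤in))
    where
    In Out : RuleIx A → ℕ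
    In q  = ind A (tgt q) ℓ * X q
    Out q = ind A (src q) ℓ * X q
    out>0 : 0 < ∑ (nR A) Out
    out>0 = ℕP.<-≤-trans (subst (0 <_) (sym (trans (cong (_* X r) (ind-refl ℓ)) (ℕP.*-identityˡ (X r)))) Xr>0)
                         (term≤∑ (nR A) Out r)
    balance : + κ τ' ℓ ≡ + ∑ (nR A) In ℤ.- + ∑ (nR A) Out
    balance = sym (begin
      + ∑ (nR A) In ℤ.- + ∑ (nR A) Out ≡⟨ condL ℓ ⟩
      + κ τ' ℓ ℤ.- + κ τ ℓ             ≡⟨ cong (λ k → + κ τ' ℓ ℤ.- + k) empty ⟩
      + κ τ' ℓ ℤ.- + 0                 ≡⟨ ℤP.+-identityʳ (+ κ τ' ℓ) ⟩
      + κ τ' ℓ                         ∎)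
      where open ≡-Reasoning
    out≤in : ∑ (nR A) Out ≤ ∑ (nR A) In
    out≤in = subst (∑ (nR A) Out ≤_) (+k≡+m-+n⇒n+k≡m balance) (ℕP.m≤m+n _ _)
    entering : ∃[ q ] 0 < In q → ∃[ q ] 0 < X q × tgt q ≡ ℓ
    entering (q , Inq>0) = let enters , Xq>0 = ind-*-pos (tgt q) ℓ (X q) Inq>0 in q , Xq>0 , enters

module Firing (A : TA) (σ σ' : Config A) (Y : Assignment A)
  (base : Base A σ σ') (condL : CondL A σ σ' Y) (condΓ : CondΓ A σ σ' Y)
  (condR : CondR A σ Y) (condAppl : CondAppl A σ Y)
  (t : RuleIx A) (Yt>0 : 0 < Y t) (ℓ₀-occupied : 0 < κ σ (from (rule A t)))
  (acyclic : ¬ FireableCycle A (from (rule A t)) Y) where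

  private
    src tgt : RuleIx A → Loc A
    src r = from (rule A r)
    tgt r = to (rule A r)

  ℓ₀ ℓ₁ : Loc A
  ℓ₀ = src t
  ℓ₁ = tgt t

  σ₁ : Config A
  σ₁ = apply A t σ

  Z : Assignment A
  Z = updateAt Y t pred

  Z-at-t : Z t + 1 ≡ Y t
  Z-at-t = begin
    Z t + 1          ≡⟨ cong (_+ 1) (updateAt-updates t Y) ⟩
    pred (Y t) + 1   ≡⟨ ℕP.+-comm (pred (Y t)) 1 ⟩
    suc (pred (Y t)) ≡⟨ ℕP.suc-pred (Y t) {{ℕ.>-nonZero Yt>0}} ⟩
    Y t              ∎
    where open ≡-Reasoning

  Z-elsewhere : ∀ {r} → r ≢ t → Z r ≡ Y r
  Z-elsewhere {r} r≢t = updateAt-minimal r t Y r≢t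

  Z>0⇒Y>0 : ∀ {r} → 0 < Z r → 0 < Y r
  Z>0⇒Y>0 {r} Zr>0 with r ≟ t
  ... | yes refl = Yt>0
  ... | no r≢t   = subst (0 <_) (Z-elsewhere r≢t) Zr>0

  Y>0⇒Z>0 : ∀ {r} → r ≢ t → 0 < Y r → 0 < Z r
  Y>0⇒Z>0 r≢t = subst (0 <_) (sym (Z-elsewhere r≢t))

  ∑-weighted-Y : ∀ (h : RuleIx A → ℕ) → ∑ (nR A) (λ r → h r * Y r) ≡ ∑ (nR A) (λ r → h r * Z r) + h t
  ∑-weighted-Y h = ∑-perturb (nR A) _ _ t (h t) at-t (λ r r≢t → cong (h r *_) (sym (Z-elsewhere r≢t)))
    where
    at-t : h t * Y t ≡ h t * Z t + h t
    at-t = begin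
      h t * Y t           ≡⟨ cong (h t *_) Z-at-t ⟨
      h t * (Z t + 1)     ≡⟨ ℕP.*-distribˡ-+ (h t) (Z t) 1 ⟩
      h t * Z t + h t * 1 ≡⟨ cong (λ k → h t * Z t + k) (ℕP.*-identityʳ (h t)) ⟩
      h t * Z t + h t     ∎
      where open ≡-Reasoning

  Z<Y : _<A_ A Z Y
  Z<Y = subst (∑ (nR A) Z <_) (sym ∑Y≡∑Z+1) (ℕP.m<m+n _ ℕP.0<1+n)
    where
    ∑Y≡∑Z+1 : ∑ (nR A) Y ≡ ∑ (nR A) Z + 1
    ∑Y≡∑Z+1 = ∑-perturb (nR A) Y Z t 1 (sym Z-at-t) (λ r r≢t → sym (Z-elsewhere r≢t))

  κ₁-balance : ∀ ℓ → κ σ₁ ℓ + ind A ℓ₀ ℓ ≡ κ σ ℓ + ind A ℓ₁ ℓ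
  κ₁-balance ℓ rewrite ind-sym A ℓ₀ ℓ | ind-sym A ℓ₁ ℓ =
    trans (+-right-comm (κ σ ℓ ∸ ind A ℓ ℓ₀) (ind A ℓ ℓ₁) (ind A ℓ ℓ₀))
          (cong (_+ ind A ℓ ℓ₁) (ℕP.m∸n+n≡m leaving≤κ))
    where
    leaving≤κ : ind A ℓ ℓ₀ ≤ κ σ ℓ
    leaving≤κ with ℓ ≟ ℓ₀
    ... | yes refl = ℓ₀-occupied
    ... | no _     = z≤n

  κ₁-off-ℓ₀ : ∀ {ℓ} → ℓ ≢ ℓ₀ → 0 < κ σ ℓ → 0 < κ σ₁ ℓ
  κ₁-off-ℓ₀ {ℓ} ℓ≢ℓ₀ occupied rewrite ind-≢ A ℓ≢ℓ₀ = ℕP.≤-trans occupied (ℕP.m≤m+n _ _)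

  κ₁-at-ℓ₁ : 0 < κ σ₁ ℓ₁
  κ₁-at-ℓ₁ rewrite ind-refl A ℓ₁ = ℕP.m≤n+m 1 _

  condL₁ : CondL A σ₁ σ' Z
  condL₁ ℓ = net-flow-shift (∑ (nR A) (λ r → ind A (tgt r) ℓ * Z r)) (∑ (nR A) (λ r → ind A (src r) ℓ * Z r))
                            (ind A ℓ₁ ℓ) (ind A ℓ₀ ℓ) (κ σ ℓ) (κ σ₁ ℓ) (κ σ' ℓ)
    (trans (sym (cong₂ (λ i o → + i ℤ.- + o) (∑-weighted-Y (λ r → ind A (tgt r) ℓ))
                                              (∑-weighted-Y (λ r → ind A (src r) ℓ))))
           (condL ℓ))
    (κ₁-balance ℓ)

  condΓ₁ : CondΓ A σ₁ σ' Z
  condΓ₁ z = +s+c≡+m-+n⇒+s≡+m-+[n+c] _ (w t) (g σ' z) (g σ z) (begin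
    + (∑ (nR A) (λ r → Z r * w r) + w t) ≡⟨ cong (λ s → + (s + w t)) (∑-cong (nR A) (λ r → ℕP.*-comm (Z r) (w r))) ⟩
    + (∑ (nR A) (λ r → w r * Z r) + w t) ≡⟨ cong +_ (∑-weighted-Y w) ⟨
    + ∑ (nR A) (λ r → w r * Y r)         ≡⟨ cong +_ (∑-cong (nR A) (λ r → ℕP.*-comm (w r) (Y r))) ⟩
    + ∑ (nR A) (λ r → Y r * w r)         ≡⟨ condΓ z ⟩
    + g σ' z ℤ.- + g σ z                 ∎)
    where
    open ≡-Reasoning
    w : RuleIx A → ℕ
    w r = B→ℕ (u (rule A r) z)

  context : SameContext A σ σ'
  context = proj₂ (proj₂ (proj₂ base))

  σ≼σ₁ : _≼_ A σ σ₁
  σ≼σ₁ = refl , λ z → ℕP.m≤m+n _ _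

  σ₁≼σ' : _≼_ A σ₁ σ'
  σ₁≼σ' = proj₁ base , CondΓ⇒shared-≤ A {σ₁} {σ'} {Z} condΓ₁

  base₁ : Base A σ₁ σ'
  base₁ = let p≡p' , rc , N≡N' , _ = base in
    p≡p' , rc , N≡N' , context-between A σ≼σ₁ σ₁≼σ' context

  condR₁ : CondR A σ₁ Z
  condR₁ r Zr>0 {gd} gd∈φ =
    guard-persists A σ≼σ₁ σ₁≼σ' context gd (r , gd∈φ) (condR r (Z>0⇒Y>0 Zr>0) gd∈φ)

  YPath ZPath : Loc A → Loc A → Set
  YPath = Star (Step A (Active A Y))
  ZPath = Star (Step A (Active A Z))

  avoiding⇒active : ∀ {r} → Avoiding A ℓ₀ (Active A Y) r → Active A Z r
  avoiding⇒active (Yr>0 , r-off-ℓ₀) = Y>0⇒Z>0 (r-off-ℓ₀ ∘ cong src) Yr>0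

  reach-ℓ₀ : ∀ {r} → 0 < Z r → src r ≡ ℓ₀ → Reachable A σ₁ (Active A Z) ℓ₀
  reach-ℓ₀ {r} Zr>0 r-from-ℓ₀ with 0 ℕP.<? κ σ₁ ℓ₀
  ... | yes occupied = ℓ₀ , occupied , ε
  ... | no empty with inflow A {σ₁} {σ'} {Z} condL₁ (ℕP.n≤0⇒n≡0 (ℕP.≮⇒≥ empty)) Zr>0 r-from-ℓ₀
  ...   | q , Zq>0 , q-to-ℓ₀ with appl⇒reachable A {σ} {Y} condAppl q (Z>0⇒Y>0 Zq>0)
  ...     | ℓ , occupied , path with lastVisit A ℓ₀ path
  ...       | avoids ℓ≢ℓ₀ rest =
    ℓ , κ₁-off-ℓ₀ ℓ≢ℓ₀ occupied ,
    subst (ZPath ℓ) q-to-ℓ₀ (Star.map (step-map A avoiding⇒active) rest ◅◅ fire Zq>0 ◅ ε)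
  ...       | endsAt q-from-ℓ₀ =
    ⊥-elim (acyclic (cycle A {Y} (subst (YPath ℓ₀) (sym q-from-ℓ₀) ε) (Z>0⇒Y>0 Zq>0) q-to-ℓ₀))
  ...       | exitsBy Ys>0 s-from-ℓ₀ rest =
    ⊥-elim (acyclic (cycle A {Y}
      (subst (λ x → YPath x (src q)) s-from-ℓ₀ (fire Ys>0 ◅ Star.map (step-map A proj₁) rest))
      (Z>0⇒Y>0 Zq>0) q-to-ℓ₀))

  via-ℓ₀ : ∀ {s m} → 0 < Z s → src s ≡ ℓ₀ → ZPath (tgt s) m → Reachable A σ₁ (Active A Z) m
  via-ℓ₀ {s} Zs>0 s-from-ℓ₀ rest with reach-ℓ₀ Zs>0 s-from-ℓ₀
  ... | ℓ , occupied , to-ℓ₀ =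
    ℓ , occupied , subst (ZPath ℓ) (sym s-from-ℓ₀) to-ℓ₀ ◅◅ fire Zs>0 ◅ rest

  reach : ∀ r → 0 < Z r → Reachable A σ₁ (Active A Z) (src r)
  reach r Zr>0 with appl⇒reachable A {σ} {Y} condAppl r (Z>0⇒Y>0 Zr>0)
  ... | ℓ , occupied , path with lastVisit A ℓ₀ path
  ...   | avoids ℓ≢ℓ₀ rest = ℓ , κ₁-off-ℓ₀ ℓ≢ℓ₀ occupied , Star.map (step-map A avoiding⇒active) rest
  ...   | endsAt r-from-ℓ₀ = subst (Reachable A σ₁ (Active A Z)) (sym r-from-ℓ₀) (reach-ℓ₀ Zr>0 r-from-ℓ₀)
  ...   | exitsBy {s} Ys>0 s-from-ℓ₀ rest with s ≟ t
  ...     | yes refl = ℓ₁ , κ₁-at-ℓ₁ , Star.map (step-map A avoiding⇒active) rest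
  ...     | no s≢t = via-ℓ₀ (Y>0⇒Z>0 s≢t Ys>0) s-from-ℓ₀ (Star.map (step-map A avoiding⇒active) rest)

  steady₁ : SteadyWith A σ₁ σ' Z
  steady₁ = base₁ , condL₁ , condΓ₁ , condR₁ , reachable⇒appl A {σ₁} {Z} reach

lemma2 : (A : TA) (σ σ' : Config A) → IsConfig A σ → IsConfig A σ' →
    (Y : Assignment A) → SteadyWith A σ σ' Y →
    (t : RuleIx A) → 0 < Y t → 0 < Config.κ σ (from (rule A t)) →
    ¬ FireableCycle A (from (rule A t)) Y →
    Σ (Assignment A) (λ Z → SteadyWith A (apply A t σ) σ' Z × _<A_ A Z Y)
lemma2 A σ σ' _ _ Y (base , condL , condΓ , condR , condAppl) t Yt>0 ℓ₀-occupied acyclic =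
  Z , steady₁ , Z<Y
  where open Firing A σ σ' Y base condL condΓ condR condAppl t Yt>0 ℓ₀-occupied acyclic
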